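{- Let $\beta$ be odd and let $\mathcal C=\langle (b\mid 0),(\ell\mid fh+2f)\rangle$ be a $\mathbb{Z}_2\mathbb{Z}_4$-additive cyclic code of type $(\alpha,\beta;\gamma,\delta;\kappa)$, where $f,g,h\in\mathbb{Z}_4[x]$ are monic pairwise coprime with $fgh=x^\beta-1$, $b,\ell\in\mathbb{Z}_2[x]$, $b\mid x^\alpha-1$, $\deg(\ell)<\deg(b)$, and $b$ divides $\frac{x^\beta-1}{f}\ell\pmod 2$. Then the Hensel lift of $\frac{b}{\gcd(b,\ell g)}$ divides $h$.
   Context: A $\mathbb{Z}_2\mathbb{Z}_4$-additive cyclic code is a subgroup of $\mathbb{Z}_2^\alpha\times\mathbb{Z}_4^\beta$ invariant under simultaneously cyclically shifting binary and quaternary coordinates, identified with a $\mathbb{Z}_4[x]$-submodule of $R_{\alpha,\beta}=\mathbb{Z}_2[x]/(x^\alpha-1)\times\mathbb{Z}_4[x]/(x^\beta-1)$ under $\lambda\star(p\mid q)=(\lambda p\bmod2\mid\lambda q)$. Type: $\mathcal C\cong\mathbb{Z}_2^\gamma\times\mathbb{Z}_4^\delta$, $\kappa$ the dimension of the binary projection of the order-$\le2$ subcode. $\gcd(b,\ell g)$ is computed in $\mathbb{Z}_2[x]$ with $g$ reduced mod 2. For $\beta$ odd and a monic divisor $q$ of $x^\beta-1$ in $\mathbb{Z}_2[x]$, its Hensel lift is the unique monic divisor of $x^\beta-1$ in $\mathbb{Z}_4[x]$ reducing to $q$ modulo 2. -}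

module Defs where

open import Data.Nat as ℕ using (ℕ; zero; suc; _≤_; _%_)
open import Data.Nat.Divisibility using (_∣_)
open import Data.Integer as ℤ using (ℤ; +_; -_; ∣_∣)
open import Data.List using (List; []; _∷_; replicate; _++_; map)
open import Data.Product using (Σ; ∃; _×_; _,_)
open import Relation.Binary.PropositionalEquality using (_≡_)
open import Relation.Nullary using (¬_)

-- Polynomials are coefficient lists over ℤ (constant term first).
-- A polynomial over ℤ_m is represented by any integer lift of its
-- coefficients; all relations below are taken modulo m.
-- Reduction ℤ_4[x] → ℤ_2[x] is thus the identity on representatives.
Poly : Set
Poly = List ℤ

coeff : Poly → ℕ → ℤ
coeff []      _       = + 0
coeff (a ∷ p) zero    = a
coeff (a ∷ p) (suc n) = coeff p n

infixl 6 _+ₚ_ _-ₚ_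
infixl 7 _*ₚ_

_+ₚ_ : Poly → Poly → Poly
[]      +ₚ q       = q
(a ∷ p) +ₚ []      = a ∷ p
(a ∷ p) +ₚ (b ∷ q) = (a ℤ.+ b) ∷ (p +ₚ q)

negₚ : Poly → Poly
negₚ = map (λ a → - a)

_-ₚ_ : Poly → Poly → Poly
p -ₚ q = p +ₚ negₚ q

_*ₚ_ : Poly → Poly → Poly
[]      *ₚ q = []
(a ∷ p) *ₚ q = map (a ℤ.*_) q +ₚ (+ 0 ∷ (p *ₚ q))

oneₚ : Poly
oneₚ = + 1 ∷ []

xⁿ-1 : ℕ → Poly
xⁿ-1 n = (replicate n (+ 0) ++ (+ 1 ∷ [])) -ₚ oneₚ

_≡ℤ_[mod_] : ℤ → ℤ → ℕ → Set
a ≡ℤ b [mod m ] = m ∣ ∣ a ℤ.- b ∣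

_≈_[mod_] : Poly → Poly → ℕ → Set
p ≈ q [mod m ] = ∀ n → coeff p n ≡ℤ coeff q n [mod m ]

Divides : ℕ → Poly → Poly → Set
Divides m a c = ∃ λ k → (a *ₚ k) ≈ c [mod m ]

Monic : ℕ → Poly → Set
Monic m p = ∃ λ d → (coeff p d ≡ℤ + 1 [mod m ])
                  × (∀ k → suc d ≤ k → coeff p k ≡ℤ + 0 [mod m ])

-- deg p < deg q in ℤ_m[x] (q nonzero; p may be zero, deg 0 = -∞)
DegLt : ℕ → Poly → Poly → Set
DegLt m p q = ∃ λ d → ¬ (coeff q d ≡ℤ + 0 [mod m ])
                    × (∀ k → d ≤ k → coeff p k ≡ℤ + 0 [mod m ])

Coprime4 : Poly → Poly → Set
Coprime4 f g = ∃ λ u → ∃ λ v → ((u *ₚ f) +ₚ (v *ₚ g)) ≈ oneₚ [mod 4 ]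

IsGCD2 : Poly → Poly → Poly → Set
IsGCD2 d a c = Monic 2 d × Divides 2 d a × Divides 2 d c
             × (∀ e → Divides 2 e a → Divides 2 e c → Divides 2 e d)

-- H is the Hensel lift (to ℤ_4[x]) of q ∈ ℤ_2[x] w.r.t. x^β - 1:
-- monic divisor of x^β - 1 in ℤ_4[x] reducing to q modulo 2
IsHenselLift : ℕ → Poly → Poly → Set
IsHenselLift β q H = Monic 4 H × Divides 4 H (xⁿ-1 β) × H ≈ q [mod 2 ]

-- Write d = gcd(b, ℓg) in ℤ₂[x], b = d·q and ℓg = d·m; H is the Hensel lift of q.
--   1. By Euclid's algorithm d is a multiple of a combination ub + vℓg, and d is
--      cancellable since ℤ₂[x] has no zero divisors and d ≠ 0 (as b ≠ 0); hence
--      the cofactors q and m are coprime.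
--   2. From b ∣ ghℓ, cancelling d gives q ∣ m·h, so q ∣ h by Gauss's lemma.
--   3. h is coprime to f and to g, hence so is its divisor q, hence q is coprime
--      to fg in ℤ₂[x]; so is H ≡ q (mod 2).
--   4. Coprimality lifts from ℤ₂[x] to ℤ₄[x], because X ≡ 1 (mod 2) implies
--      X² ≡ 1 (mod 4).
--   5. H ∣ x^β - 1 = fgh in ℤ₄[x] and H is coprime to fg, so H ∣ h by Gauss.
module Submission where

open import Defs
open import Data.Nat using (ℕ; _%_)
open import Relation.Binary.PropositionalEquality using (_≡_)
open import Data.Product using (_,_)
open import Algebra.Bundles using (CommutativeRing)
import Algebra.Solver.Ring.NaturalCoefficients.Default

-- Congruence of integers modulo m.  It is wrapped in a record so that the
-- two integers can be inferred from the type, which the bare divisibility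
-- statement of Defs does not allow.
module IntegerCongruence where
  open import Data.Nat using (zero; suc; s≤s)
  import Data.Nat.Divisibility as ℕ∣
  open import Data.Integer using (ℤ; +_; -_; _+_; _*_; _-_)
  import Data.Integer.Divisibility.Signed as ℤ∣
  open import Data.Integer.DivMod using (_%ℕ_; _/ℕ_; a≡a%ℕn+[a/ℕn]*n; n%ℕd<d)
  open import Data.Integer.Tactic.RingSolver using (solve-∀)
  open import Data.Sum using (_⊎_; inj₁; inj₂)
  open import Relation.Binary.PropositionalEquality using (refl; cong; cong₂; trans; subst)
  open Relation.Binary.PropositionalEquality.≡-Reasoning
  open import Relation.Nullary using (¬_)

  infix 4 _≡[_]_
  record _≡[_]_ (a : ℤ) (m : ℕ) (b : ℤ) : Set where
    constructor mk
    field divides-difference : (+ m) ℤ∣.∣ (a - b)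
  open _≡[_]_ public

  Even Odd : ℤ → Set
  Even a = a ≡[ 2 ] + 0
  Odd a = a ≡[ 2 ] + 1

  ≡-fromDefs : ∀ {m a b} → a ≡ℤ b [mod m ] → a ≡[ m ] b
  ≡-fromDefs p = mk (ℤ∣.∣ᵤ⇒∣ p)

  ≡-toDefs : ∀ {m a b} → a ≡[ m ] b → a ≡ℤ b [mod m ]
  ≡-toDefs p = ℤ∣.∣⇒∣ᵤ (divides-difference p)

  mod-reflexive : ∀ {m a b} → a ≡ b → a ≡[ m ] b
  mod-reflexive {m} {a} refl = mk (ℤ∣.divides (+ 0) (a-a≡0 a (+ m)))
    where a-a≡0 : ∀ a m → a - a ≡ + 0 * m
          a-a≡0 = solve-∀

  mod-refl : ∀ {m} a → a ≡[ m ] a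
  mod-refl a = mod-reflexive refl

  mod-sym : ∀ {m a b} → a ≡[ m ] b → b ≡[ m ] a
  mod-sym {a = a} {b} (mk p) = mk (subst (_ ℤ∣.∣_) (flip a b) (ℤ∣.∣m⇒∣-m p))
    where flip : ∀ a b → - (a - b) ≡ b - a
          flip = solve-∀

  mod-trans : ∀ {m a b c} → a ≡[ m ] b → b ≡[ m ] c → a ≡[ m ] c
  mod-trans {a = a} {b} {c} (mk p) (mk q) = mk (subst (_ ℤ∣.∣_) (telescope a b c) (ℤ∣.∣m∣n⇒∣m+n p q))
    where telescope : ∀ a b c → (a - b) + (b - c) ≡ a - c
          telescope = solve-∀

  mod-+ : ∀ {m a a′ b b′} → a ≡[ m ] a′ → b ≡[ m ] b′ → a + b ≡[ m ] a′ + b′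
  mod-+ {a = a} {a′} {b} {b′} (mk p) (mk q) = mk (subst (_ ℤ∣.∣_) (regroup a a′ b b′) (ℤ∣.∣m∣n⇒∣m+n p q))
    where regroup : ∀ a a′ b b′ → (a - a′) + (b - b′) ≡ (a + b) - (a′ + b′)
          regroup = solve-∀

  mod-neg : ∀ {m a a′} → a ≡[ m ] a′ → - a ≡[ m ] - a′
  mod-neg {a = a} {a′} (mk p) = mk (subst (_ ℤ∣.∣_) (negate a a′) (ℤ∣.∣m⇒∣-m p))
    where negate : ∀ a a′ → - (a - a′) ≡ (- a) - (- a′)
          negate = solve-∀

  mod-* : ∀ {m a a′ b b′} → a ≡[ m ] a′ → b ≡[ m ] b′ → a * b ≡[ m ] a′ * b′
  mod-* {a = a} {a′} {b} {b′} (mk p) (mk q) =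
    mk (subst (_ ℤ∣.∣_) (expand a a′ b b′) (ℤ∣.∣m∣n⇒∣m+n (ℤ∣.∣n⇒∣m*n a q) (ℤ∣.∣m⇒∣m*n b′ p)))
    where expand : ∀ a a′ b b′ → a * (b - b′) + (a - a′) * b′ ≡ a * b - a′ * b′
          expand = solve-∀

  mod-4⇒2 : ∀ {a b} → a ≡[ 4 ] b → a ≡[ 2 ] b
  mod-4⇒2 p = ≡-fromDefs (ℕ∣.∣-trans (ℕ∣.divides 2 refl) (≡-toDefs p))

  even*even : ∀ {a b} → Even a → Even b → a * b ≡[ 4 ] + 0
  even*even {a} {b} (mk (ℤ∣.divides k a≡2k)) (mk (ℤ∣.divides l b≡2l)) =
    mk (ℤ∣.divides (k * l) (begin
      a * b - + 0              ≡⟨ unshift a b ⟩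
      (a - + 0) * (b - + 0)    ≡⟨ cong₂ _*_ a≡2k b≡2l ⟩
      (k * + 2) * (l * + 2)    ≡⟨ collect k l ⟩
      (k * l) * + 4            ∎))
    where unshift : ∀ a b → a * b - + 0 ≡ (a - + 0) * (b - + 0)
          unshift = solve-∀
          collect : ∀ k l → (k * + 2) * (l * + 2) ≡ (k * l) * + 4
          collect = solve-∀

  even+even : ∀ {a} → Even a → a + a ≡[ 4 ] + 0
  even+even {a} (mk (ℤ∣.divides k a≡2k)) =
    mk (ℤ∣.divides k (trans (double a) (trans (cong (_* + 2) a≡2k) (collect k))))
    where double : ∀ a → (a + a) - + 0 ≡ (a - + 0) * + 2
          double = solve-∀
          collect : ∀ k → (k * + 2) * + 2 ≡ k * + 4
          collect = solve-∀

  parity : ∀ a → Even a ⊎ Odd a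
  parity a with a %ℕ 2 | n%ℕd<d a 2 | a≡a%ℕn+[a/ℕn]*n a 2
  ... | zero | _ | a≡2q = inj₁ (mk (ℤ∣.divides (a /ℕ 2) (trans (cong (_- + 0) a≡2q) (shift (a /ℕ 2)))))
    where shift : ∀ q → (+ 0 + q * + 2) - + 0 ≡ q * + 2
          shift = solve-∀
  ... | suc zero | _ | a≡2q+1 = inj₂ (mk (ℤ∣.divides (a /ℕ 2) (trans (cong (_- + 1) a≡2q+1) (shift (a /ℕ 2)))))
    where shift : ∀ q → (+ 1 + q * + 2) - + 1 ≡ q * + 2
          shift = solve-∀
  ... | suc (suc _) | s≤s (s≤s ()) | _

  odd⇒¬even : ∀ {a} → Odd a → ¬ Even a
  odd⇒¬even odd even with ≡-toDefs (mod-trans (mod-sym even) odd)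
  ... | ℕ∣.divides zero ()
  ... | ℕ∣.divides (suc k) ()

open IntegerCongruence

module Coefficients where
  open import Data.Nat using (zero; suc; _<_; z≤n; s≤s)
  import Data.Nat as ℕ
  import Data.Nat.Properties as ℕₚ
  open import Data.Integer using (ℤ; +_; -_; _+_; _*_)
  import Data.Integer.Properties as ℤₚ
  open import Data.Integer.Tactic.RingSolver using (solve-∀)
  open import Data.List using ([]; _∷_; map; replicate; _++_)
  open import Relation.Binary.PropositionalEquality using (refl; sym; trans; cong; cong₂)

  Seq : Set
  Seq = ℕ → ℤ

  tail : Seq → Seq
  tail c k = c (suc k)

  -- conv c d n = Σ_{i+j=n} c i * d j
  conv : Seq → Seq → Seq
  conv c d zero    = c 0 * d 0
  conv c d (suc n) = c 0 * d (suc n) + conv (tail c) d n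

  conv-cong : ∀ {m} {c c′ d d′ : Seq} → (∀ k → c k ≡[ m ] c′ k) → (∀ k → d k ≡[ m ] d′ k)
    → ∀ n → conv c d n ≡[ m ] conv c′ d′ n
  conv-cong c≡ d≡ zero    = mod-* (c≡ 0) (d≡ 0)
  conv-cong c≡ d≡ (suc n) = mod-+ (mod-* (c≡ 0) (d≡ (suc n))) (conv-cong (λ k → c≡ (suc k)) d≡ n)

  conv-congˡ : ∀ {c c′ : Seq} (d : Seq) → (∀ k → c k ≡ c′ k) → ∀ n → conv c d n ≡ conv c′ d n
  conv-congˡ d c≡ zero    = cong (_* d 0) (c≡ 0)
  conv-congˡ d c≡ (suc n) = cong₂ _+_ (cong (_* d (suc n)) (c≡ 0)) (conv-congˡ d (λ k → c≡ (suc k)) n)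

  conv-congʳ : ∀ (c : Seq) {d d′ : Seq} → (∀ k → d k ≡ d′ k) → ∀ n → conv c d n ≡ conv c d′ n
  conv-congʳ c d≡ zero    = cong (c 0 *_) (d≡ 0)
  conv-congʳ c d≡ (suc n) = cong₂ _+_ (cong (c 0 *_) (d≡ (suc n))) (conv-congʳ (tail c) d≡ n)

  conv-zeroˡ : ∀ (d : Seq) n → conv (λ _ → + 0) d n ≡ + 0
  conv-zeroˡ d zero    = refl
  conv-zeroˡ d (suc n) = cong (_+_ (+ 0 * d (suc n))) (conv-zeroˡ d n)

  conv-distribʳ : ∀ (c c′ d : Seq) n → conv (λ k → c k + c′ k) d n ≡ conv c d n + conv c′ d n
  conv-distribʳ c c′ d zero    = ℤₚ.*-distribʳ-+ (d 0) (c 0) (c′ 0)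
  conv-distribʳ c c′ d (suc n) =
    trans (cong (_+_ ((c 0 + c′ 0) * d (suc n))) (conv-distribʳ (tail c) (tail c′) d n))
          (interchange (c 0) (c′ 0) (d (suc n)) (conv (tail c) d n) (conv (tail c′) d n))
    where interchange : ∀ a a′ x y y′ → (a + a′) * x + (y + y′) ≡ (a * x + y) + (a′ * x + y′)
          interchange = solve-∀

  conv-scaleˡ : ∀ a (c d : Seq) n → conv (λ k → a * c k) d n ≡ a * conv c d n
  conv-scaleˡ a c d zero    = ℤₚ.*-assoc a (c 0) (d 0)
  conv-scaleˡ a c d (suc n) =
    trans (cong (_+_ (a * c 0 * d (suc n))) (conv-scaleˡ a (tail c) d n))
          (factor a (c 0) (d (suc n)) (conv (tail c) d n))
    where factor : ∀ a b x y → a * b * x + a * y ≡ a * (b * x + y)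
          factor = solve-∀

  conv-comm : ∀ (c d : Seq) n → conv c d n ≡ conv d c n
  conv-comm c d zero    = ℤₚ.*-comm (c 0) (d 0)
  conv-comm c d (suc n) =
    trans (cong (_+_ (c 0 * d (suc n))) (conv-comm (tail c) d n))
          (trans (swap-heads n) (cong (_+_ (d 0 * c (suc n))) (sym (conv-comm (tail d) c n))))
    where
    -- peel off the other head: both sides equal c₀dₙ₊₁ + d₀cₙ₊₁ + Σ cᵢ₊₁dⱼ₊₁
    swap-heads : ∀ n → c 0 * d (suc n) + conv d (tail c) n ≡ d 0 * c (suc n) + conv c (tail d) n
    swap-heads zero    = ℤₚ.+-comm (c 0 * d 1) (d 0 * c 1)
    swap-heads (suc k) =
      trans (cong (λ z → c 0 * d (suc (suc k)) + (d 0 * c (suc (suc k)) + z)) (conv-comm (tail d) (tail c) k))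
            (exchange (c 0 * d (suc (suc k))) (d 0 * c (suc (suc k))) _)
      where exchange : ∀ x y z → x + (y + z) ≡ y + (x + z)
            exchange = solve-∀

  conv-assoc : ∀ (c d e : Seq) n → conv (conv c d) e n ≡ conv c (conv d e) n
  conv-assoc c d e zero    = ℤₚ.*-assoc (c 0) (d 0) (e 0)
  conv-assoc c d e (suc n) =
    trans (cong (_+_ (c 0 * d 0 * e (suc n)))
            (trans (conv-distribʳ (λ k → c 0 * d (suc k)) (conv (tail c) d) e n)
                   (cong₂ _+_ (conv-scaleˡ (c 0) (tail d) e n) (conv-assoc (tail c) d e n))))
          (factor (c 0) (d 0) (e (suc n)) (conv (tail d) e n) (conv (tail c) (conv d e) n))
    where factor : ∀ a b x y z → a * b * x + (a * y + z) ≡ a * (b * x + y) + z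
          factor = solve-∀

  conv-constant : ∀ t (d : Seq) n → conv (coeff (t ∷ [])) d n ≡ t * d n
  conv-constant t d zero    = refl
  conv-constant t d (suc n) = trans (cong (_+_ (t * d (suc n))) (conv-zeroˡ d n)) (ℤₚ.+-identityʳ _)

  conv-top : ∀ {m} e₁ e₂ (c d : Seq) → (∀ k → e₁ < k → c k ≡[ m ] + 0) → (∀ k → e₂ < k → d k ≡[ m ] + 0)
    → conv c d (e₁ ℕ.+ e₂) ≡[ m ] c e₁ * d e₂
  conv-top zero e₂ c d c-van d-van = head e₂
    where
    head : ∀ n → conv c d n ≡[ _ ] c 0 * d n
    head zero    = mod-refl _
    head (suc n) = mod-trans (mod-+ (mod-refl (c 0 * d (suc n)))
                                    (mod-trans (conv-cong (λ k → c-van (suc k) (s≤s z≤n)) (λ k → mod-refl (d k)) n)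
                                               (mod-reflexive (conv-zeroˡ d n))))
                             (mod-reflexive (ℤₚ.+-identityʳ _))
  conv-top (suc e₁) e₂ c d c-van d-van =
    mod-trans (mod-+ (mod-* (mod-refl (c 0)) (d-van (suc (e₁ ℕ.+ e₂)) (s≤s (ℕₚ.m≤n+m e₂ e₁))))
                     (conv-top e₁ e₂ (tail c) d (λ k e₁<k → c-van (suc k) (s≤s e₁<k)) d-van))
              (mod-reflexive (trans (cong (_+ (c (suc e₁) * d e₂)) (ℤₚ.*-zeroʳ (c 0))) (ℤₚ.+-identityˡ _)))

  coeff-+ : ∀ p q n → coeff (p +ₚ q) n ≡ coeff p n + coeff q n
  coeff-+ []      q       n       = sym (ℤₚ.+-identityˡ _)
  coeff-+ (a ∷ p) []      zero    = sym (ℤₚ.+-identityʳ _)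
  coeff-+ (a ∷ p) []      (suc n) = sym (ℤₚ.+-identityʳ _)
  coeff-+ (a ∷ p) (b ∷ q) zero    = refl
  coeff-+ (a ∷ p) (b ∷ q) (suc n) = coeff-+ p q n

  coeff-scale : ∀ a q n → coeff (map (a *_) q) n ≡ a * coeff q n
  coeff-scale a []      n       = sym (ℤₚ.*-zeroʳ a)
  coeff-scale a (b ∷ q) zero    = refl
  coeff-scale a (b ∷ q) (suc n) = coeff-scale a q n

  coeff-neg : ∀ q n → coeff (negₚ q) n ≡ - coeff q n
  coeff-neg []      n       = refl
  coeff-neg (b ∷ q) zero    = refl
  coeff-neg (b ∷ q) (suc n) = coeff-neg q n

  coeff-* : ∀ p q n → coeff (p *ₚ q) n ≡ conv (coeff p) (coeff q) n
  coeff-* []      q n       = sym (conv-zeroˡ (coeff q) n)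
  coeff-* (a ∷ p) q zero    = trans (coeff-+ (map (a *_) q) (+ 0 ∷ (p *ₚ q)) 0)
                                    (trans (cong (_+ + 0) (coeff-scale a q 0)) (ℤₚ.+-identityʳ _))
  coeff-* (a ∷ p) q (suc n) = trans (coeff-+ (map (a *_) q) (+ 0 ∷ (p *ₚ q)) (suc n))
                                    (cong₂ _+_ (coeff-scale a q (suc n)) (coeff-* p q n))

  conv-even : ∀ (c d : Seq) → (∀ k → Even (c k)) → (∀ k → Even (d k)) → ∀ n → conv c d n ≡[ 4 ] + 0
  conv-even c d c-even d-even zero    = even*even (c-even 0) (d-even 0)
  conv-even c d c-even d-even (suc n) =
    mod-+ (even*even (c-even 0) (d-even (suc n))) (conv-even (tail c) d (λ k → c-even (suc k)) d-even n)

  monomial : ℕ → ℤ → Poly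
  monomial j t = replicate j (+ 0) ++ (t ∷ [])

  coeff-*-monomial : ∀ c j t i → coeff (c *ₚ monomial j t) (j ℕ.+ i) ≡ t * coeff c i
  coeff-*-monomial c j t i =
    trans (coeff-* c (monomial j t) (j ℕ.+ i))
          (trans (conv-comm (coeff c) (coeff (monomial j t)) (j ℕ.+ i)) (shifted j))
    where
    shifted : ∀ j → conv (coeff (monomial j t)) (coeff c) (j ℕ.+ i) ≡ t * coeff c i
    shifted zero    = conv-constant t (coeff c) i
    shifted (suc j) = trans (ℤₚ.+-identityˡ _) (shifted j)

open Coefficients

module PolynomialsMod where
  open import Data.Integer using (+_; -_; _+_; _*_)
  import Data.Integer.Properties as ℤₚ
  open import Data.List using ([])
  open import Data.Product using (_,_)
  open import Level using (0ℓ)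
  open import Relation.Binary.PropositionalEquality using (refl; sym; trans; cong; cong₂)

  infix 4 _≈[_]_
  record _≈[_]_ (p : Poly) (m : ℕ) (q : Poly) : Set where
    constructor mkP
    field at : ∀ n → coeff p n ≡[ m ] coeff q n
  open _≈[_]_ public

  ≈-fromDefs : ∀ {m p q} → p ≈ q [mod m ] → p ≈[ m ] q
  ≈-fromDefs e = mkP (λ n → ≡-fromDefs (e n))

  ≈-toDefs : ∀ {m p q} → p ≈[ m ] q → p ≈ q [mod m ]
  ≈-toDefs e n = ≡-toDefs (at e n)

  ≈-4⇒2 : ∀ {p q} → p ≈[ 4 ] q → p ≈[ 2 ] q
  ≈-4⇒2 e = mkP (λ n → mod-4⇒2 (at e n))

  ext : ∀ {m p q} → (∀ n → coeff p n ≡ coeff q n) → p ≈[ m ] q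
  ext e = mkP (λ n → mod-reflexive (e n))

  ≈-refl : ∀ {m p} → p ≈[ m ] p
  ≈-refl = mkP (λ n → mod-refl _)

  ≈-sym : ∀ {m p q} → p ≈[ m ] q → q ≈[ m ] p
  ≈-sym e = mkP (λ n → mod-sym (at e n))

  ≈-trans : ∀ {m p q r} → p ≈[ m ] q → q ≈[ m ] r → p ≈[ m ] r
  ≈-trans e f = mkP (λ n → mod-trans (at e n) (at f n))

  +-cong : ∀ {m p p′ q q′} → p ≈[ m ] p′ → q ≈[ m ] q′ → p +ₚ q ≈[ m ] p′ +ₚ q′
  +-cong {p = p} {p′} {q} {q′} e f = mkP (λ n →
    mod-trans (mod-reflexive (coeff-+ p q n))
      (mod-trans (mod-+ (at e n) (at f n)) (mod-reflexive (sym (coeff-+ p′ q′ n)))))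

  neg-cong : ∀ {m p p′} → p ≈[ m ] p′ → negₚ p ≈[ m ] negₚ p′
  neg-cong {p = p} {p′} e = mkP (λ n →
    mod-trans (mod-reflexive (coeff-neg p n))
      (mod-trans (mod-neg (at e n)) (mod-reflexive (sym (coeff-neg p′ n)))))

  *-cong : ∀ {m p p′ q q′} → p ≈[ m ] p′ → q ≈[ m ] q′ → p *ₚ q ≈[ m ] p′ *ₚ q′
  *-cong {p = p} {p′} {q} {q′} e f = mkP (λ n →
    mod-trans (mod-reflexive (coeff-* p q n))
      (mod-trans (conv-cong (at e) (at f) n) (mod-reflexive (sym (coeff-* p′ q′ n)))))

  +-comm : ∀ {m} p q → p +ₚ q ≈[ m ] q +ₚ p
  +-comm p q = ext (λ n → trans (coeff-+ p q n) (trans (ℤₚ.+-comm (coeff p n) (coeff q n)) (sym (coeff-+ q p n))))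

  +-assoc : ∀ {m} p q r → (p +ₚ q) +ₚ r ≈[ m ] p +ₚ (q +ₚ r)
  +-assoc p q r = ext (λ n →
    trans (coeff-+ (p +ₚ q) r n)
      (trans (cong (_+ coeff r n) (coeff-+ p q n))
        (trans (ℤₚ.+-assoc (coeff p n) (coeff q n) (coeff r n))
          (sym (trans (coeff-+ p (q +ₚ r) n) (cong (_+_ (coeff p n)) (coeff-+ q r n)))))))

  +-identityˡ : ∀ {m} p → [] +ₚ p ≈[ m ] p
  +-identityˡ p = ≈-refl

  +-identityʳ : ∀ {m} p → p +ₚ [] ≈[ m ] p
  +-identityʳ p = ext (λ n → trans (coeff-+ p [] n) (ℤₚ.+-identityʳ (coeff p n)))

  +-inverseʳ : ∀ {m} p → p +ₚ negₚ p ≈[ m ] []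
  +-inverseʳ p = ext (λ n →
    trans (coeff-+ p (negₚ p) n) (trans (cong (_+_ (coeff p n)) (coeff-neg p n)) (ℤₚ.+-inverseʳ (coeff p n))))

  +-inverseˡ : ∀ {m} p → negₚ p +ₚ p ≈[ m ] []
  +-inverseˡ p = ≈-trans (+-comm (negₚ p) p) (+-inverseʳ p)

  *-comm : ∀ {m} p q → p *ₚ q ≈[ m ] q *ₚ p
  *-comm p q = ext (λ n → trans (coeff-* p q n) (trans (conv-comm (coeff p) (coeff q) n) (sym (coeff-* q p n))))

  *-assoc : ∀ {m} p q r → (p *ₚ q) *ₚ r ≈[ m ] p *ₚ (q *ₚ r)
  *-assoc p q r = ext (λ n →
    trans (coeff-* (p *ₚ q) r n)
      (trans (conv-congˡ (coeff r) (coeff-* p q) n)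
        (trans (conv-assoc (coeff p) (coeff q) (coeff r) n)
          (sym (trans (coeff-* p (q *ₚ r) n) (conv-congʳ (coeff p) (coeff-* q r) n))))))

  *-identityˡ : ∀ {m} p → oneₚ *ₚ p ≈[ m ] p
  *-identityˡ p = ext (λ n → trans (coeff-* oneₚ p n) (trans (conv-constant (+ 1) (coeff p) n) (ℤₚ.*-identityˡ _)))

  *-identityʳ : ∀ {m} p → p *ₚ oneₚ ≈[ m ] p
  *-identityʳ p = ≈-trans (*-comm p oneₚ) (*-identityˡ p)

  distribʳ : ∀ {m} p q r → (q +ₚ r) *ₚ p ≈[ m ] q *ₚ p +ₚ r *ₚ p
  distribʳ p q r = ext (λ n →
    trans (coeff-* (q +ₚ r) p n)
      (trans (conv-congˡ (coeff p) (coeff-+ q r) n)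
        (trans (conv-distribʳ (coeff q) (coeff r) (coeff p) n)
          (sym (trans (coeff-+ (q *ₚ p) (r *ₚ p) n) (cong₂ _+_ (coeff-* q p n) (coeff-* r p n)))))))

  distribˡ : ∀ {m} p q r → p *ₚ (q +ₚ r) ≈[ m ] p *ₚ q +ₚ p *ₚ r
  distribˡ p q r = ≈-trans (*-comm p (q +ₚ r)) (≈-trans (distribʳ p q r) (+-cong (*-comm q p) (*-comm r p)))

  PolyRing : ℕ → CommutativeRing 0ℓ 0ℓ
  PolyRing m = record
    { Carrier = Poly ; _≈_ = λ p q → p ≈[ m ] q
    ; _+_ = _+ₚ_ ; _*_ = _*ₚ_ ; -_ = negₚ ; 0# = [] ; 1# = oneₚ
    ; isCommutativeRing = record
      { isRing = record
        { +-isAbelianGroup = record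
          { isGroup = record
            { isMonoid = record
              { isSemigroup = record
                { isMagma = record
                  { isEquivalence = record { refl = ≈-refl ; sym = ≈-sym ; trans = ≈-trans }
                  ; ∙-cong = +-cong }
                ; assoc = +-assoc }
              ; identity = +-identityˡ , +-identityʳ }
            ; inverse = +-inverseˡ , +-inverseʳ
            ; ⁻¹-cong = neg-cong }
          ; comm = +-comm }
        ; *-cong = *-cong
        ; *-assoc = *-assoc
        ; *-identity = *-identityˡ , *-identityʳ
        ; distrib = distribˡ , distribʳ }
      ; *-comm = *-comm } }

open PolynomialsMod using (_≈[_]_; mkP; at; ≈-fromDefs; ≈-toDefs; ≈-4⇒2; ext; ≈-refl; ≈-sym; ≈-trans; PolyRing)

module RingFacts {r ℓ} (R : CommutativeRing r ℓ) where
  open import Level using (_⊔_)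
  open import Data.Product using (∃; ∃₂; _×_; _,_)
  open CommutativeRing R
  open import Algebra.Properties.Ring ring using (x[y-z]≈xy-xz; x≈y⇒x∙y⁻¹≈ε; x∙y⁻¹≈ε⇒x≈y)
  open import Relation.Binary.Reasoning.Setoid setoid

  module Solver = Algebra.Solver.Ring.NaturalCoefficients.Default commutativeSemiring
  open Solver using (solve; _:=_; _:+_; _:*_)

  -- The relations below are records so that their arguments can be inferred.
  infix 4 _∣_
  record _∣_ (a b : Carrier) : Set (r ⊔ ℓ) where
    constructor divides
    field
      quotient : Carrier
      equation : a * quotient ≈ b

  ∣-respˡ : ∀ {a a′ b} → a ≈ a′ → a ∣ b → a′ ∣ b
  ∣-respˡ a≈a′ (divides k ak≈b) = divides k (trans (*-congʳ (sym a≈a′)) ak≈b)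

  ∣-respʳ : ∀ {a b b′} → b ≈ b′ → a ∣ b → a ∣ b′
  ∣-respʳ b≈b′ (divides k ak≈b) = divides k (trans ak≈b b≈b′)

  record Coprime (a b : Carrier) : Set (r ⊔ ℓ) where
    constructor coprime
    field
      u v      : Carrier
      identity : u * a + v * b ≈ 1#

  coprime-sym : ∀ {a b} → Coprime a b → Coprime b a
  coprime-sym (coprime u v e) = coprime v u (trans (+-comm _ _) e)

  coprime-respˡ : ∀ {a a′ b} → a ≈ a′ → Coprime a b → Coprime a′ b
  coprime-respˡ a≈a′ (coprime u v e) = coprime u v (trans (+-congʳ (*-congˡ (sym a≈a′))) e)

  coprime-divisor : ∀ {a b c} → a ∣ b → Coprime b c → Coprime a c
  coprime-divisor {a} {b} {c} (divides k ak≈b) (coprime u v e) = coprime (u * k) v (begin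
    u * k * a + v * c      ≈⟨ +-congʳ (solve 3 (λ u k a → u :* k :* a := u :* (a :* k)) refl u k a) ⟩
    u * (a * k) + v * c    ≈⟨ +-congʳ (*-congˡ ak≈b) ⟩
    u * b + v * c          ≈⟨ e ⟩
    1#                     ∎)

  coprime-* : ∀ {a b c} → Coprime a b → Coprime a c → Coprime a (b * c)
  coprime-* {a} {b} {c} (coprime u v e) (coprime u′ v′ e′) = coprime (u * u′ * a + u * v′ * c + v * b * u′) (v * v′) (begin
    (u * u′ * a + u * v′ * c + v * b * u′) * a + v * v′ * (b * c)
      ≈⟨ solve 7 (λ u a v b u′ v′ c →
           (u :* a :+ v :* b) :* (u′ :* a :+ v′ :* c)
             := (u :* u′ :* a :+ u :* v′ :* c :+ v :* b :* u′) :* a :+ v :* v′ :* (b :* c))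
           refl u a v b u′ v′ c ⟨
    (u * a + v * b) * (u′ * a + v′ * c)   ≈⟨ *-cong e e′ ⟩
    1# * 1#                                ≈⟨ *-identityˡ 1# ⟩
    1#                                     ∎)

  gauss : ∀ {a b c} → Coprime a b → a ∣ b * c → a ∣ c
  gauss {a} {b} {c} (coprime u v e) (divides k ak≈bc) = divides (u * c + v * k) (begin
    a * (u * c + v * k)            ≈⟨ solve 5 (λ a u c v k → a :* (u :* c :+ v :* k) := u :* a :* c :+ v :* (a :* k)) refl a u c v k ⟩
    u * a * c + v * (a * k)        ≈⟨ +-congˡ (*-congˡ ak≈bc) ⟩
    u * a * c + v * (b * c)        ≈⟨ solve 5 (λ u a c v b → u :* a :* c :+ v :* (b :* c) := (u :* a :+ v :* b) :* c) refl u a c v b ⟩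
    (u * a + v * b) * c            ≈⟨ *-congʳ e ⟩
    1# * c                         ≈⟨ *-identityˡ c ⟩
    c                              ∎)

  record Cancellative (d : Carrier) : Set (r ⊔ ℓ) where
    constructor cancellative
    field cancel : ∀ {x y} → d * x ≈ d * y → x ≈ y

  nonZeroDivisor⇒cancellative : ∀ {d} → (∀ {x} → d * x ≈ 0# → x ≈ 0#) → Cancellative d
  nonZeroDivisor⇒cancellative {d} nzd = cancellative λ {x} {y} dx≈dy →
    x∙y⁻¹≈ε⇒x≈y x y (nzd (trans (x[y-z]≈xy-xz d x y) (x≈y⇒x∙y⁻¹≈ε dx≈dy)))

  cofactors-coprime : ∀ {d q m a b} → Cancellative d → d * q ≈ a → d * m ≈ b
    → (∃₂ λ u v → (u * a + v * b) ∣ d) → Coprime q m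
  cofactors-coprime {d} {q} {m} {a} {b} (cancellative cancel) dq≈a dm≈b (u , v , divides k combination*k≈d) =
    coprime (u * k) (v * k) (sym (cancel (begin
      d * 1#                              ≈⟨ *-identityʳ d ⟩
      d                                   ≈⟨ combination*k≈d ⟨
      (u * a + v * b) * k                 ≈⟨ *-congʳ (+-cong (*-congˡ dq≈a) (*-congˡ dm≈b)) ⟨
      (u * (d * q) + v * (d * m)) * k     ≈⟨ solve 6 (λ u d q v m k →
                                               (u :* (d :* q) :+ v :* (d :* m)) :* k := d :* (u :* k :* q :+ v :* k :* m))
                                               refl u d q v m k ⟩
      d * (u * k * q + v * k * m)         ∎)))

  cofactor-divides : ∀ {d q m a b h} → Cancellative d → d * q ≈ a → d * m ≈ b
    → a ∣ b * h → q ∣ m * h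
  cofactor-divides {d} {q} {m} {a} {b} {h} (cancellative cancel) dq≈a dm≈b (divides t at≈bh) = divides t (cancel (begin
    d * (q * t)       ≈⟨ *-assoc d q t ⟨
    d * q * t         ≈⟨ *-congʳ dq≈a ⟩
    a * t             ≈⟨ at≈bh ⟩
    b * h             ≈⟨ *-congʳ dm≈b ⟨
    d * m * h         ≈⟨ *-assoc d m h ⟩
    d * (m * h)       ∎))

  subtract-add : ∀ x y → x ≈ (x + - y) + y
  subtract-add x y = sym (begin
    (x + - y) + y     ≈⟨ +-assoc x (- y) y ⟩
    x + (- y + y)     ≈⟨ +-congˡ (-‿inverseˡ y) ⟩
    x + 0#            ≈⟨ +-identityʳ x ⟩
    x                 ∎)

  BezoutGcd : Carrier → Carrier → Set (r ⊔ ℓ)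
  BezoutGcd a b = ∃ λ D → (∃₂ λ u v → D ≈ u * a + v * b) × D ∣ a × D ∣ b

  bezout-zero : ∀ {a b} → b ≈ 0# → BezoutGcd a b
  bezout-zero {a} {b} b≈0 =
    a , (1# , 0# , sym (trans (+-cong (*-identityˡ a) (zeroˡ b)) (+-identityʳ a)))
      , divides 1# (*-identityʳ a) , divides 0# (trans (zeroʳ a) (sym b≈0))

  bezout-step : ∀ {a b s r} → a ≈ b * s + r → BezoutGcd b r → BezoutGcd a b
  bezout-step {a} {b} {s} {r} a≈bs+r (D , (u , v , D≈ub+vr) , divides k₁ Dk₁≈b , divides k₂ Dk₂≈r) =
    D , (v , u + - (v * s) , combination) , divides (k₁ * s + k₂) D∣a , divides k₁ Dk₁≈b
    where
    cancelled : v * s * b + - (v * s) * b ≈ 0#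
    cancelled = begin
      v * s * b + - (v * s) * b    ≈⟨ distribʳ b (v * s) (- (v * s)) ⟨
      (v * s + - (v * s)) * b      ≈⟨ *-congʳ (-‿inverseʳ (v * s)) ⟩
      0# * b                       ≈⟨ zeroˡ b ⟩
      0#                           ∎
    combination : D ≈ v * a + (u + - (v * s)) * b
    combination = begin
      D                                            ≈⟨ D≈ub+vr ⟩
      u * b + v * r                                ≈⟨ +-identityʳ _ ⟨
      u * b + v * r + 0#                           ≈⟨ +-congˡ cancelled ⟨
      u * b + v * r + (v * s * b + - (v * s) * b)  ≈⟨ solve 6 (λ u b v r s n →
                                                        u :* b :+ v :* r :+ (v :* s :* b :+ n :* b)
                                                          := v :* (b :* s :+ r) :+ (u :+ n) :* b)
                                                        refl u b v r s (- (v * s)) ⟩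
      v * (b * s + r) + (u + - (v * s)) * b        ≈⟨ +-congʳ (*-congˡ a≈bs+r) ⟨
      v * a + (u + - (v * s)) * b                  ∎
    D∣a : D * (k₁ * s + k₂) ≈ a
    D∣a = begin
      D * (k₁ * s + k₂)       ≈⟨ solve 4 (λ D k₁ s k₂ → D :* (k₁ :* s :+ k₂) := D :* k₁ :* s :+ D :* k₂) refl D k₁ s k₂ ⟩
      D * k₁ * s + D * k₂     ≈⟨ +-cong (*-congʳ Dk₁≈b) Dk₂≈r ⟩
      b * s + r               ≈⟨ a≈bs+r ⟨
      a                       ∎

  gcd-combination : ∀ {a b d} → BezoutGcd a b → (∀ e → e ∣ a → e ∣ b → e ∣ d)
    → ∃₂ λ u v → (u * a + v * b) ∣ d
  gcd-combination (D , (u , v , D≈ua+vb) , D∣a , D∣b) universal =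
    u , v , ∣-respˡ D≈ua+vb (universal D D∣a D∣b)

module ℤ₂ = RingFacts (PolyRing 2)
module ℤ₄ = RingFacts (PolyRing 4)

module Binary where
  open import Data.Nat using (zero; suc; _≤_; _<_; z≤n; s≤s; _∸_; _≤?_)
  import Data.Nat as ℕ
  import Data.Nat.Properties as ℕₚ
  open import Data.Integer using (+_; -_; _+_; _*_)
  open import Data.Integer.Tactic.RingSolver using (solve-∀)
  open import Data.List using ([]; _∷_; length)
  open import Data.Product using (∃; ∃₂; _×_; _,_)
  open import Data.Sum using (_⊎_; inj₁; inj₂)
  open import Data.Empty using (⊥-elim)
  open import Relation.Nullary using (¬_; yes; no)
  open import Relation.Binary.PropositionalEquality using (refl; sym; trans; cong; cong₂; subst)
  open CommutativeRing (PolyRing 2) using (zeroʳ; +-congʳ)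
  open ℤ₂.Solver using (solve; _:=_; _:+_; _:*_)

  VanishesFrom : Poly → ℕ → Set
  VanishesFrom p N = ∀ k → N ≤ k → Even (coeff p k)

  record Degree (p : Poly) (e : ℕ) : Set where
    constructor degree
    field
      leading-odd : Odd (coeff p e)
      vanishes-above : VanishesFrom p (suc e)

  vanishesFrom-length : ∀ p → VanishesFrom p (length p)
  vanishesFrom-length []      k       _         = mod-refl _
  vanishesFrom-length (a ∷ p) (suc k) (s≤s len≤k) = vanishesFrom-length p k len≤k

  zero-or-degree : ∀ N p → VanishesFrom p N → p ≈[ 2 ] [] ⊎ ∃ λ e → e < N × Degree p e
  zero-or-degree zero    p van = inj₁ (mkP (λ n → van n z≤n))
  zero-or-degree (suc N) p van with parity (coeff p N)
  ... | inj₂ odd  = inj₂ (N , ℕₚ.≤-refl , degree odd van)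
  ... | inj₁ even with zero-or-degree N p van′
    where van′ : VanishesFrom p N
          van′ k N≤k with ℕₚ.m≤n⇒m<n∨m≡n N≤k
          ... | inj₁ N<k = van k N<k
          ... | inj₂ refl = even
  ...   | inj₁ p≈0             = inj₁ p≈0
  ...   | inj₂ (e , e<N , deg) = inj₂ (e , ℕₚ.m≤n⇒m≤1+n e<N , deg)

  degree-of-nonzero : ∀ {p} → ¬ (p ≈[ 2 ] []) → ∃ (Degree p)
  degree-of-nonzero {p} p≉0 with zero-or-degree (length p) p (vanishesFrom-length p)
  ... | inj₁ p≈0          = ⊥-elim (p≉0 p≈0)
  ... | inj₂ (e , _ , deg) = e , deg

  leading-* : ∀ {c d e₁ e₂} → Degree c e₁ → Degree d e₂ → Odd (coeff (c *ₚ d) (e₁ ℕ.+ e₂))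
  leading-* {c} {d} {e₁} {e₂} (degree c-odd c-van) (degree d-odd d-van) =
    mod-trans (mod-reflexive (coeff-* c d (e₁ ℕ.+ e₂)))
      (mod-trans (conv-top e₁ e₂ (coeff c) (coeff d) c-van d-van) (mod-* c-odd d-odd))

  -- ℤ₂[x] has no zero divisors: the leading coefficient of c·x would be odd
  noZeroDivisors : ∀ {c e x} → Degree c e → c *ₚ x ≈[ 2 ] [] → x ≈[ 2 ] []
  noZeroDivisors {c} {e} {x} deg cx≈0 with zero-or-degree (length x) x (vanishesFrom-length x)
  ... | inj₁ x≈0              = x≈0
  ... | inj₂ (e′ , _ , deg′) = ⊥-elim (odd⇒¬even (leading-* deg deg′) (at cx≈0 (e ℕ.+ e′)))

  nonzero⇒cancellative : ∀ {c} → ¬ (c ≈[ 2 ] []) → ℤ₂.Cancellative c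
  nonzero⇒cancellative {c} c≉0 with degree-of-nonzero c≉0
  ... | _ , deg = ℤ₂.nonZeroDivisor⇒cancellative {d = c} (noZeroDivisors deg)

  quotient-term : ℕ → ℕ → Poly → Poly
  quotient-term e N a = monomial (N ∸ e) (coeff a N)

  eliminate-top : ∀ {c e N} a → Degree c e → e ≤ N → VanishesFrom a (suc N)
    → VanishesFrom (a -ₚ c *ₚ quotient-term e N a) N
  eliminate-top {c} {e} {N} a (degree c-odd c-van) e≤N a-van k N≤k =
    subst (λ k → Even (coeff a′ k)) (ℕₚ.m+[n∸m]≡n N≤k) (above (k ∸ N))
    where
    t = coeff a N
    a′ = a -ₚ c *ₚ quotient-term e N a
    shifted : ∀ i → coeff (c *ₚ monomial (N ∸ e) t) (N ℕ.+ i) ≡ t * coeff c (e ℕ.+ i)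
    shifted i = trans (cong (coeff (c *ₚ monomial (N ∸ e) t))
                        (trans (cong (ℕ._+ i) (sym (ℕₚ.m∸n+n≡m e≤N))) (ℕₚ.+-assoc (N ∸ e) e i)))
                      (coeff-*-monomial c (N ∸ e) t (e ℕ.+ i))
    coeff-a′ : ∀ i → coeff a′ (N ℕ.+ i) ≡ coeff a (N ℕ.+ i) + - (t * coeff c (e ℕ.+ i))
    coeff-a′ i = trans (coeff-+ a (negₚ (c *ₚ monomial (N ∸ e) t)) (N ℕ.+ i))
                       (cong (_+_ (coeff a (N ℕ.+ i))) (trans (coeff-neg (c *ₚ monomial (N ∸ e) t) (N ℕ.+ i)) (cong -_ (shifted i))))
    above : ∀ i → Even (coeff a′ (N ℕ.+ i))
    above zero    = mod-trans (mod-reflexive (trans (coeff-a′ 0) (cong₂ (λ x y → x + - (t * coeff c y))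
                                                   (cong (coeff a) (ℕₚ.+-identityʳ N)) (ℕₚ.+-identityʳ e))))
                      (mod-trans (mod-+ (mod-refl t) (mod-neg (mod-* (mod-refl t) c-odd)))
                        (mod-reflexive (t-t≡0 t)))
      where t-t≡0 : ∀ t → t + - (t * + 1) ≡ + 0
            t-t≡0 = solve-∀
    above (suc i) = mod-trans (mod-reflexive (coeff-a′ (suc i)))
                      (mod-trans (mod-+ (a-van (N ℕ.+ suc i) (ℕₚ.m<m+n N (s≤s z≤n)))
                                        (mod-neg (mod-* (mod-refl t) (c-van (e ℕ.+ suc i) (ℕₚ.m<m+n e (s≤s z≤n))))))
                        (mod-reflexive (zero-zero t)))
      where zero-zero : ∀ t → + 0 + - (t * + 0) ≡ + 0
            zero-zero = solve-∀

  division : ∀ {c e} → Degree c e → ∀ N a → VanishesFrom a N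
    → ∃₂ λ s r → a ≈[ 2 ] c *ₚ s +ₚ r × VanishesFrom r e
  division {c} {e} deg N a a-van with N ≤? e
  ... | yes N≤e = [] , a , a≈c*0+a , λ k e≤k → a-van k (ℕₚ.≤-trans N≤e e≤k)
    where a≈c*0+a : a ≈[ 2 ] c *ₚ [] +ₚ a
          a≈c*0+a = ≈-sym (+-congʳ (zeroʳ c))
  division {c} {e} deg zero    a a-van | no N≰e = ⊥-elim (N≰e z≤n)
  division {c} {e} deg (suc N) a a-van | no N≰e
    with division deg N (a -ₚ c *ₚ quotient-term e N a) (eliminate-top a deg (ℕₚ.≤-pred (ℕₚ.≰⇒> N≰e)) a-van)
  ... | s , r , a′≈cs+r , r-van = s +ₚ m , r , a≈ , r-van
    where
    m = quotient-term e N a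
    a≈ : a ≈[ 2 ] c *ₚ (s +ₚ m) +ₚ r
    a≈ = ≈-trans (ℤ₂.subtract-add a (c *ₚ m))
           (≈-trans (+-congʳ a′≈cs+r)
             (solve 4 (λ c s r m → c :* s :+ r :+ c :* m := c :* (s :+ m) :+ r) ≈-refl c s r m))

  euclid : ∀ N a b → VanishesFrom b N → ℤ₂.BezoutGcd a b
  euclid zero    a b b-van = ℤ₂.bezout-zero (mkP (λ n → b-van n z≤n))
  euclid (suc N) a b b-van with zero-or-degree (suc N) b b-van
  ... | inj₁ b≈0 = ℤ₂.bezout-zero b≈0
  ... | inj₂ (e , s≤s e≤N , deg) with division deg (length a) a (vanishesFrom-length a)
  ...   | s , r , a≈bs+r , r-van =
    ℤ₂.bezout-step a≈bs+r (euclid N b r (λ k N≤k → r-van k (ℕₚ.≤-trans e≤N N≤k)))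

-- Coprimality in ℤ₂[x] lifts to ℤ₄[x]: a polynomial X ≡ 1 (mod 2) satisfies
-- X² ≡ 1 (mod 4), so X·(uH + vF) = X² is a Bézout identity modulo 4.
module Lift where
  open import Data.List using ([])
  open import Algebra.Properties.Ring (CommutativeRing.ring (PolyRing 2)) using (x≈y⇒x∙y⁻¹≈ε)
  open CommutativeRing (PolyRing 4) using (setoid; +-cong; *-cong; +-identityˡ)
  open import Relation.Binary.Reasoning.Setoid setoid
  open ℤ₄.Solver using (solve; _:=_; _:+_; _:*_; con)

  even-square : ∀ {E} → E ≈[ 2 ] [] → E *ₚ E ≈[ 4 ] []
  even-square {E} E≈0 = mkP (λ n → mod-trans (mod-reflexive (coeff-* E E n))
                                             (conv-even (coeff E) (coeff E) (at E≈0) (at E≈0) n))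

  even-double : ∀ {E} → E ≈[ 2 ] [] → E +ₚ E ≈[ 4 ] []
  even-double {E} E≈0 = mkP (λ n → mod-trans (mod-reflexive (coeff-+ E E n)) (even+even (at E≈0 n)))

  -- X ≡ 1 (mod 2) implies X² ≡ 1 (mod 4): write X = 1 + E with E even
  square-of-unit : ∀ {X} → X ≈[ 2 ] oneₚ → X *ₚ X ≈[ 4 ] oneₚ
  square-of-unit {X} X≈1 = begin
    X *ₚ X                              ≈⟨ *-cong X≈E+1 X≈E+1 ⟩
    (E +ₚ oneₚ) *ₚ (E +ₚ oneₚ)          ≈⟨ solve 1 (λ e → (e :+ con 1) :* (e :+ con 1) := e :* e :+ (e :+ e) :+ con 1) ≈-refl E ⟩
    E *ₚ E +ₚ (E +ₚ E) +ₚ oneₚ          ≈⟨ +-cong (+-cong (even-square E≈0) (even-double E≈0)) ≈-refl ⟩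
    [] +ₚ [] +ₚ oneₚ                    ≈⟨ +-identityˡ oneₚ ⟩
    oneₚ                                ∎
    where
    E = X +ₚ negₚ oneₚ
    E≈0 : E ≈[ 2 ] []
    E≈0 = x≈y⇒x∙y⁻¹≈ε X≈1
    X≈E+1 : X ≈[ 4 ] E +ₚ oneₚ
    X≈E+1 = ℤ₄.subtract-add X oneₚ

  coprime-lift : ∀ {a b} → ℤ₂.Coprime a b → ℤ₄.Coprime a b
  coprime-lift {a} {b} (ℤ₂.coprime u v ua+vb≈1) = ℤ₄.coprime (X *ₚ u) (X *ₚ v) (begin
    X *ₚ u *ₚ a +ₚ X *ₚ v *ₚ b     ≈⟨ solve 5 (λ x u a v b → x :* u :* a :+ x :* v :* b := x :* (u :* a :+ v :* b)) ≈-refl X u a v b ⟩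
    X *ₚ X                         ≈⟨ square-of-unit ua+vb≈1 ⟩
    oneₚ                           ∎)
    where X = u *ₚ a +ₚ v *ₚ b

module DefsTranslation {m : ℕ} where
  open RingFacts (PolyRing m) using (_∣_; divides)

  ∣-fromDefs : ∀ {a c} → Divides m a c → a ∣ c
  ∣-fromDefs (k , ak≈c) = divides k (≈-fromDefs ak≈c)

  ∣-toDefs : ∀ {a c} → a ∣ c → Divides m a c
  ∣-toDefs (divides k ak≈c) = k , ≈-toDefs ak≈c

coprime₂ : ∀ {a b} → Coprime4 a b → ℤ₂.Coprime a b
coprime₂ (u , v , ua+vb≈1) = ℤ₂.coprime u v (≈-4⇒2 (≈-fromDefs ua+vb≈1))

mainTheorem11 : (α β : ℕ) (f g h b ℓ : Poly)
    → β % 2 ≡ 1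
    → Monic 4 f → Monic 4 g → Monic 4 h
    → Coprime4 f g → Coprime4 f h → Coprime4 g h
    → ((f *ₚ g) *ₚ h) ≈ xⁿ-1 β [mod 4 ]
    → Divides 2 b (xⁿ-1 α)
    → DegLt 2 ℓ b
    → Divides 2 b ((g *ₚ h) *ₚ ℓ)
    → (d : Poly) → IsGCD2 d b (ℓ *ₚ g)
    → (q : Poly) → (d *ₚ q) ≈ b [mod 2 ]
    → (H : Poly) → IsHenselLift β q H
    → Divides 4 H h
mainTheorem11 α β f g h b ℓ _ _ _ _ _ f⊥h g⊥h fgh≈xᵝ-1 _ (i , bᵢ≢0 , _) b∣ghℓ
              d (_ , _ , (m , dm≈ℓg) , d-gcd) q dq≈b H (_ , H∣xᵝ-1 , H≈q) = ∣-toDefs H∣h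
  where
  open CommutativeRing (PolyRing 2) using (*-congʳ; zeroˡ)
  open ℤ₂.Solver using (solve; _:=_; _:*_)
  open DefsTranslation

  dq : d *ₚ q ≈[ 2 ] b
  dq = ≈-fromDefs dq≈b
  dm : d *ₚ m ≈[ 2 ] ℓ *ₚ g
  dm = ≈-fromDefs dm≈ℓg

  -- d ≠ 0, since d·q = b has a nonzero coefficient
  d-cancel : ℤ₂.Cancellative d
  d-cancel = Binary.nonzero⇒cancellative λ d≈0 →
    bᵢ≢0 (≈-toDefs (≈-trans (≈-sym dq) (≈-trans (*-congʳ d≈0) (zeroˡ q))) i)

  q⊥m : ℤ₂.Coprime q m
  q⊥m = ℤ₂.cofactors-coprime d-cancel dq dm
          (ℤ₂.gcd-combination (Binary.euclid _ b (ℓ *ₚ g) (Binary.vanishesFrom-length (ℓ *ₚ g)))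
                              (λ e e∣b e∣ℓg → ∣-fromDefs (d-gcd e (∣-toDefs e∣b) (∣-toDefs e∣ℓg))))

  b∣ℓgh : ℤ₂._∣_ b (ℓ *ₚ g *ₚ h)
  b∣ℓgh = ℤ₂.∣-respʳ (solve 3 (λ g h ℓ → g :* h :* ℓ := ℓ :* g :* h) ≈-refl g h ℓ) (∣-fromDefs b∣ghℓ)

  q∣h : ℤ₂._∣_ q h
  q∣h = ℤ₂.gauss q⊥m (ℤ₂.cofactor-divides d-cancel dq dm b∣ℓgh)

  q⊥ : ∀ {x} → Coprime4 x h → ℤ₂.Coprime q x
  q⊥ x⊥h = ℤ₂.coprime-divisor q∣h (ℤ₂.coprime-sym (coprime₂ x⊥h))

  H⊥fg : ℤ₄.Coprime H (f *ₚ g)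
  H⊥fg = Lift.coprime-lift (ℤ₂.coprime-respˡ (≈-sym (≈-fromDefs H≈q)) (ℤ₂.coprime-* (q⊥ f⊥h) (q⊥ g⊥h)))

  H∣fgh : ℤ₄._∣_ H (f *ₚ g *ₚ h)
  H∣fgh = ℤ₄.∣-respʳ (≈-sym (≈-fromDefs fgh≈xᵝ-1)) (∣-fromDefs {c = xⁿ-1 β} H∣xᵝ-1)

  H∣h : ℤ₄._∣_ H h
  H∣h = ℤ₄.gauss H⊥fg H∣fgh
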